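{- Let $G$ and $H$ be graphs, $v\in V(G)$ and $w\in V(H)$. Then $\mu\big((G\sqcup H)+vw\big)=\mu(G\sqcup H)-1$ if both $T(v,G)$ and $T(w,H)$ hold, and $\mu\big((G\sqcup H)+vw\big)=\mu(G\sqcup H)$ otherwise.
   Context: All graphs are finite and simple with nonempty vertex set. $\sqcup$ is disjoint union and $(G\sqcup H)+vw$ is the graph obtained by adding the edge $vw$. A path may consist of a single vertex; its terminal vertices are its endpoints (a one-vertex path has that vertex as terminal vertex). An $s$-path covering of $G$ is a set of $s$ vertex-disjoint paths in $G$ containing every vertex of $G$. $\mu(G)$ is the minimum $s\in\mathbb{N}$ such that $G$ has an $s$-path covering; a minimal path covering is a $\mu(G)$-path covering. For $v\in V(G)$, $T(v,G)$ is the statement that $v$ is a terminal vertex of some path in some minimal path covering of $G$. -}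

module Defs where

open import Data.Nat using (ℕ; _+_; _≤_)
open import Data.Fin using (Fin; _↑ˡ_; _↑ʳ_; splitAt; _≟_)
open import Data.Bool using (Bool; true; false; _∨_; _∧_)
open import Data.Sum using (_⊎_; inj₁; inj₂)
open import Data.Product using (Σ; _×_; _,_; ∃)
open import Data.List using (List; length; concatMap)
open import Data.List.NonEmpty using (List⁺; head; last; toList)
open import Data.List.Relation.Unary.All using (All)
open import Data.List.Relation.Unary.Any using (Any)
open import Data.List.Relation.Unary.Unique.Propositional using (Unique)
open import Data.List.Relation.Unary.Linked using (Linked)
open import Data.List.Membership.Propositional using (_∈_)
open import Relation.Binary.PropositionalEquality using (_≡_)
open import Relation.Nullary.Decidable using (⌊_⌋)

record Graph : Set where
  field
    n   : ℕ
    adj : Fin n → Fin n → Bool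
open Graph public

record IsSimpleGraph (G : Graph) : Set where
  field
    symmetric  : ∀ x y → adj G x y ≡ adj G y x
    irreflexive : ∀ x → adj G x x ≡ false
    nonempty   : Fin (n G)

-- Disjoint union: vertices of G are x ↑ˡ n H, vertices of H are n G ↑ʳ y.
_⊔_ : Graph → Graph → Graph
G ⊔ H = record { n = n G + n H ; adj = a }
  where
  a : Fin (n G + n H) → Fin (n G + n H) → Bool
  a x y with splitAt (n G) x | splitAt (n G) y
  ... | inj₁ x' | inj₁ y' = adj G x' y'
  ... | inj₂ x' | inj₂ y' = adj H x' y'
  ... | _       | _       = false

addEdge : (G : Graph) → Fin (n G) → Fin (n G) → Graph
addEdge G v w = record { n = n G ; adj = a }
  where
  a : Fin (n G) → Fin (n G) → Bool
  a x y = adj G x y ∨ (⌊ x ≟ v ⌋ ∧ ⌊ y ≟ w ⌋) ∨ (⌊ x ≟ w ⌋ ∧ ⌊ y ≟ v ⌋)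

joinAt : (G H : Graph) → Fin (n G) → Fin (n H) → Graph
joinAt G H v w = addEdge (G ⊔ H) (v ↑ˡ n H) (n G ↑ʳ w)

-- A path: nonempty sequence of vertices, consecutive ones adjacent
-- (distinctness of vertices is enforced by the covering condition below).
IsPath : (G : Graph) → List⁺ (Fin (n G)) → Set
IsPath G p = Linked (λ x y → adj G x y ≡ true) (toList p)

record PathCovering (G : Graph) (C : List (List⁺ (Fin (n G)))) : Set where
  field
    paths    : All (IsPath G) C
    disjoint : Unique (concatMap toList C)
    covers   : ∀ x → x ∈ concatMap toList C

HasCovering : Graph → ℕ → Set
HasCovering G s = Σ (List (List⁺ (Fin (n G)))) λ C → PathCovering G C × length C ≡ s

IsMu : Graph → ℕ → Set
IsMu G s = HasCovering G s × (∀ t → HasCovering G t → s ≤ t)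

Terminal : {m : ℕ} → Fin m → List⁺ (Fin m) → Set
Terminal v p = (v ≡ head p) ⊎ (v ≡ last p)

T : (G : Graph) → Fin (n G) → Set
T G v = Σ (List (List⁺ (Fin (n G)))) λ C →
          PathCovering G C × IsMu G (length C) × Any (Terminal v) C

module Submission where

-- Deleting the edge vw from a path covering of (G ⊔ H) + vw cuts at most one path, at vw (the
-- vertices of a path are distinct), so μ(G ⊔ H) ≤ μ((G ⊔ H) + vw) + 1, and equality forces the cut
-- covering to be minimal with v and w terminal. Every path of G ⊔ H lies in G or in H, so a minimal
-- covering of G ⊔ H restricts to minimal coverings of G and H, in which v and w are then terminal.
-- Conversely, if v ends a path of a minimal covering of G and w starts one of H, joining these two
-- paths through vw covers (G ⊔ H) + vw with μ(G) + μ(H) − 1 ≤ μ(G ⊔ H) − 1 paths.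

open import Defs
open import Data.Bool using (true; false; _∨_; _∧_)
open import Data.Bool.Properties using (T-≡; T-∨; T-∧)
open import Data.Empty using (⊥; ⊥-elim)
open import Data.Fin using (Fin; _↑ˡ_; _↑ʳ_; splitAt; _≟_)
open import Data.Fin.Properties
  using (splitAt-↑ˡ; splitAt-↑ʳ; splitAt⁻¹-↑ˡ; splitAt⁻¹-↑ʳ; ↑ˡ-injective; ↑ʳ-injective)
open import Data.List as L using (List; []; _∷_; _++_; concat; concatMap)
open import Data.List.Properties
  using (length-++; length-map; unfold-reverse; reverse-involutive; ++-assoc; map-++; concat-++;
         concatMap-map; map-concatMap)
open import Data.List.Membership.Propositional using (_∈_)
open import Data.List.Membership.Propositional.Properties
  using (∈-concatMap⁺; ∈-concatMap⁻; ∈-map⁺; ∈-map⁻; ∈-++⁺ˡ; ∈-++⁺ʳ; ∈-++⁻)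
open import Data.List.NonEmpty as N using (List⁺; _∷_; toList)
open import Data.List.Relation.Binary.Disjoint.Propositional using (Disjoint)
open import Data.List.Relation.Binary.Permutation.Propositional
  using (_↭_; refl; prep; swap; ↭-refl; ↭-sym; ↭-trans; ↭-reflexive; ↭⇒↭ₛ)
  renaming (trans to ↭-trans′)
open import Data.List.Relation.Binary.Permutation.Propositional.Properties
  using (++⁺ˡ; ++⁺ʳ; shifts; shift; ↭-length; ↭-reverse; All-resp-↭; Any-resp-↭; ∈-resp-↭)
import Data.List.Relation.Binary.Permutation.Setoid.Properties as Setoid↭
open import Data.List.Relation.Unary.All as All using (All; []; _∷_)
open import Data.List.Relation.Unary.All.Properties as All
  using (++⁻ˡ; ++⁻ʳ; All¬⇒¬Any; ¬Any⇒All¬)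
open import Data.List.Relation.Unary.Any as Any using (Any; here; there)
import Data.List.Relation.Unary.Any.Properties as Any
open import Data.List.Relation.Unary.Linked as Lk using (Linked; []; [-]; _∷_)
import Data.List.Relation.Unary.Linked.Properties as Lk
open import Data.List.Relation.Unary.Unique.Propositional using (Unique; []; _∷_)
import Data.List.Relation.Unary.Unique.Propositional.Properties as Unique
open import Data.Maybe as Maybe using (just)
open import Data.Maybe.Properties using (just-injective)
open import Data.Maybe.Relation.Binary.Connected using (Connected; just)
open import Data.Nat using (ℕ; suc; _+_; _∸_; _≤_; _≤?_; s≤s)
open import Data.Nat.Properties
  using (+-cancelˡ-≤; +-cancelʳ-≤; +-mono-≤; +-suc; ≤-trans; ≤-antisym; ≰⇒>; <⇒≱;
         module ≤-Reasoning)
open import Data.Product using (Σ; _×_; _,_; proj₁; proj₂)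
open import Data.Sum using (_⊎_; inj₁; inj₂; [_,_]′)
import Data.Vec as Vec
import Data.Vec.Properties as Vec
open import Function.Base using (_∘_)
open import Function.Bundles using (Equivalence)
open import Relation.Binary.Definitions using (Symmetric)
open import Relation.Binary.PropositionalEquality
  using (_≡_; _≢_; refl; sym; trans; cong; cong₂; subst; subst₂; setoid; module ≡-Reasoning)
open import Relation.Nullary using (¬_; yes; no)
open import Relation.Nullary.Decidable using (⌊_⌋; toWitness; fromWitness)

private variable
  A B : Set
  x : A
  xs ys : List A
  C D : List (List⁺ A)

last-∷ʳ : ∀ (xs : List A) x → L.last (xs L.∷ʳ x) ≡ just x
last-∷ʳ []           x = refl
last-∷ʳ (y ∷ [])     x = refl
last-∷ʳ (y ∷ z ∷ zs) x = last-∷ʳ (z ∷ zs) x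

last-reverse : ∀ (x : A) xs → L.last (L.reverse (x ∷ xs)) ≡ just x
last-reverse x xs rewrite unfold-reverse x xs = last-∷ʳ (L.reverse xs) x

head-reverse : ∀ (xs : List A) → L.head (L.reverse xs) ≡ L.last xs
head-reverse xs =
  subst (λ zs → L.head (L.reverse xs) ≡ L.last zs) (reverse-involutive xs)
        (head≡last-reverse (L.reverse xs))
  where
  head≡last-reverse : ∀ (ys : List A) → L.head ys ≡ L.last (L.reverse ys)
  head≡last-reverse []       = refl
  head≡last-reverse (y ∷ ys) = sym (last-reverse y ys)

Linked-reverse : {R : A → A → Set} → Symmetric R → Linked R xs → Linked R (L.reverse xs)
Linked-reverse sym-R []  = []
Linked-reverse sym-R [-] = [-]
Linked-reverse {xs = x ∷ y ∷ ys} sym-R (r ∷ l) rewrite unfold-reverse x (y ∷ ys) =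
  Lk.++⁺ (Linked-reverse sym-R l)
         (subst (λ z → Connected _ z (just x)) (sym (last-reverse y ys)) (just (sym-R r))) [-]

Unique-resp-↭ : {A : Set} {xs ys : List A} → xs ↭ ys → Unique xs → Unique ys
Unique-resp-↭ {A = A} p = Setoid↭.Unique-resp-↭ (setoid A) (↭⇒↭ₛ p)

Unique-++⁻ : ∀ (xs : List A) → Unique (xs ++ ys) → Unique xs × Unique ys × Disjoint xs ys
Unique-++⁻ []       u          = [] , u , λ ()
Unique-++⁻ (x ∷ xs) (x∉ ∷ u) with Unique-++⁻ xs u
... | u-xs , u-ys , xs#ys =
  ++⁻ˡ xs x∉ ∷ u-xs , u-ys ,
  λ { (here refl , y∈)  → All¬⇒¬Any (++⁻ʳ xs x∉) y∈
    ; (there y∈ , y∈′) → xs#ys (y∈ , y∈′)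
    }

bringToFront : {P : A → Set} → Any P xs →
               Σ A λ x → Σ (List A) λ ys → P x × xs ↭ x ∷ ys
bringToFront (here px)  = _ , _ , px , ↭-refl
bringToFront (there a) with bringToFront a
... | x , ys , px , p = x , _ ∷ ys , px , ↭-trans (prep _ p) (swap _ _ ↭-refl)

∈-map-injective⁻ : ∀ {f : A → B} → (∀ {x y} → f x ≡ f y → x ≡ y) →
                   f x ∈ L.map f xs → x ∈ xs
∈-map-injective⁻ {f = f} f-inj x∈ with ∈-map⁻ f x∈
... | y , y∈ , e = subst (_∈ _) (sym (f-inj e)) y∈

vertices : List (List⁺ A) → List A
vertices = concatMap toList

vertices-++ : ∀ (C D : List (List⁺ A)) → vertices (C ++ D) ≡ vertices C ++ vertices D
vertices-++ C D =
  trans (cong concat (map-++ toList C D)) (sym (concat-++ (L.map toList C) (L.map toList D)))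

vertices-map : ∀ (f : A → B) C → vertices (L.map (N.map f) C) ≡ L.map f (vertices C)
vertices-map f C = trans (concatMap-map toList (N.map f) C) (sym (map-concatMap f toList C))

vertices-↭ : C ↭ D → vertices C ↭ vertices D
vertices-↭ refl = ↭-refl
vertices-↭ (prep p q) = ++⁺ˡ (toList p) (vertices-↭ q)
vertices-↭ (swap p q r) =
  ↭-trans (shifts (toList p) (toList q)) (++⁺ˡ (toList q) (++⁺ˡ (toList p) (vertices-↭ r)))
vertices-↭ (↭-trans′ q r) = ↭-trans (vertices-↭ q) (vertices-↭ r)

last-toList : ∀ (p : List⁺ A) → L.last (toList p) ≡ just (N.last p)
last-toList (x ∷ xs) with L.initLast xs
... | L.[]       = refl
... | ys L.∷ʳ′ y = last-∷ʳ (x ∷ ys) y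

last-∷⁺ : ∀ (x : A) p → N.last (x N.∷⁺ p) ≡ N.last p
last-∷⁺ x p = just-injective (trans (sym (last-toList (x N.∷⁺ p))) (last-toList p))

last-map⁺ : ∀ (f : A → B) p → N.last (N.map f p) ≡ f (N.last p)
last-map⁺ f p = just-injective (begin
  just (N.last (N.map f p))  ≡⟨ last-toList (N.map f p) ⟨
  L.last (L.map f (toList p)) ≡⟨ Data.List.Properties.last-map f (toList p) ⟩
  Maybe.map f (L.last (toList p)) ≡⟨ cong (Maybe.map f) (last-toList p) ⟩
  just (f (N.last p)) ∎)
  where open ≡-Reasoning

toList-reverse : ∀ (p : List⁺ A) → toList (N.reverse p) ≡ L.reverse (toList p)
toList-reverse {A = A} (x ∷ xs) = begin
  toList (N.fromVec (Vec.reverse u))            ≡⟨ toList-fromVec (Vec.reverse u) ⟩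
  Vec.toList (Vec.reverse u)                    ≡⟨ Vec.toList-reverse u ⟩
  L.reverse (x ∷ Vec.toList (Vec.fromList xs))
    ≡⟨ cong (λ ys → L.reverse (x ∷ ys)) (Vec.toList∘fromList xs) ⟩
  L.reverse (x ∷ xs)                            ∎
  where
  open ≡-Reasoning
  u : Vec.Vec A (suc (L.length xs))
  u = x Vec.∷ Vec.fromList xs
  toList-fromVec : ∀ {k} (u : Vec.Vec A (suc k)) → toList (N.fromVec u) ≡ Vec.toList u
  toList-fromVec (y Vec.∷ ys) = refl

head-reverse⁺ : ∀ (p : List⁺ A) → N.head (N.reverse p) ≡ N.last p
head-reverse⁺ p = just-injective (begin
  L.head (toList (N.reverse p)) ≡⟨ cong L.head (toList-reverse p) ⟩
  L.head (L.reverse (toList p)) ≡⟨ head-reverse (toList p) ⟩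
  L.last (toList p)             ≡⟨ last-toList p ⟩
  just (N.last p)               ∎)
  where open ≡-Reasoning

last-reverse⁺ : ∀ (p : List⁺ A) → N.last (N.reverse p) ≡ N.head p
last-reverse⁺ p = just-injective (begin
  just (N.last (N.reverse p))    ≡⟨ last-toList (N.reverse p) ⟨
  L.last (toList (N.reverse p))  ≡⟨ cong L.last (toList-reverse p) ⟩
  L.last (L.reverse (toList p))  ≡⟨ last-reverse (N.head p) (N.tail p) ⟩
  just (N.head p)                ∎)
  where open ≡-Reasoning

Terminal-map⁻ : ∀ {k l} {f : Fin k → Fin l} {y} q → Terminal y (N.map f q) →
                Σ (Fin k) λ x → y ≡ f x × Terminal x q
Terminal-map⁻ q         (inj₁ e) = N.head q , e , inj₁ refl
Terminal-map⁻ {f = f} q (inj₂ e) = N.last q , trans e (last-map⁺ f q) , inj₂ refl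

Terminal-map-injective⁻ : ∀ {k l} {f : Fin k → Fin l} → (∀ {x y} → f x ≡ f y → x ≡ y) →
                          ∀ {x q} → Terminal (f x) (N.map f q) → Terminal x q
Terminal-map-injective⁻ f-inj {q = q} t with Terminal-map⁻ q t
... | _ , e , t′ = subst (λ z → Terminal z q) (sym (f-inj e)) t′

open PathCovering

Adjacent : (K : Graph) → Fin (n K) → Fin (n K) → Set
Adjacent K x y = adj K x y ≡ true

Paths : Graph → Set
Paths K = List (List⁺ (Fin (n K)))

MinimalCovering : (K : Graph) → Paths K → Set
MinimalCovering K C = PathCovering K C × (∀ t → HasCovering K t → L.length C ≤ t)

T-intro : ∀ {K} {C : Paths K} {v} → MinimalCovering K C → Any (Terminal v) C → T K v
T-intro (cv , minimal) t = _ , cv , ((_ , cv , refl) , minimal) , t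

PathCovering-resp : ∀ {K} {P Q : Paths K} → All (IsPath K) Q → vertices P ↭ vertices Q →
                    PathCovering K P → PathCovering K Q
PathCovering-resp ps σ cv = record
  { paths    = ps
  ; disjoint = Unique-resp-↭ σ (disjoint cv)
  ; covers   = λ x → ∈-resp-↭ σ (covers cv x)
  }

PathCovering-↭ : ∀ {K} {P Q : Paths K} → P ↭ Q → PathCovering K P → PathCovering K Q
PathCovering-↭ σ cv = PathCovering-resp (All-resp-↭ σ (paths cv)) (vertices-↭ σ) cv

PathCovering-join : ∀ {K} {p q} {P : Paths K} → Adjacent K (N.last p) (N.head q) →
                    PathCovering K (p ∷ q ∷ P) → PathCovering K ((p N.⁺++⁺ q) ∷ P)
PathCovering-join {K = K} {p = p} {q = q} {P = P} e cv with paths cv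
... | lp ∷ lq ∷ ps =
  PathCovering-resp (lpq ∷ ps) (↭-reflexive (sym (++-assoc (toList p) (toList q) (vertices P)))) cv
  where
  lpq : IsPath K (p N.⁺++⁺ q)
  lpq = Lk.++⁺ lp (subst (λ z → Connected _ z (just (N.head q))) (sym (last-toList p)) (just e)) lq

module _ {K : Graph} (symmetric : ∀ x y → adj K x y ≡ adj K y x) where

  IsPath-reverse : ∀ {p} → IsPath K p → IsPath K (N.reverse p)
  IsPath-reverse {p = p} lp =
    subst (Linked (Adjacent K)) (sym (toList-reverse p))
          (Linked-reverse (λ {x} {y} e → trans (symmetric y x) e) lp)

  PathCovering-reverse : ∀ {p} {P : Paths K} →
                         PathCovering K (p ∷ P) → PathCovering K (N.reverse p ∷ P)
  PathCovering-reverse {p = p} cv with paths cv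
  ... | lp ∷ ps = PathCovering-resp (IsPath-reverse lp ∷ ps) (++⁺ʳ _ toList-p↭) cv
    where
    toList-p↭ : toList p ↭ toList (N.reverse p)
    toList-p↭ = ↭-trans (↭-sym (↭-reverse (toList p))) (↭-reflexive (sym (toList-reverse p)))

  terminal-as-last : ∀ {P : Paths K} {v} → PathCovering K P → Any (Terminal v) P →
    Σ (List⁺ (Fin (n K))) λ p → Σ (Paths K) λ Q →
      PathCovering K (p ∷ Q) × L.length P ≡ suc (L.length Q) × N.last p ≡ v
  terminal-as-last cv t with bringToFront t
  ... | p , Q , inj₂ v≡last , σ = p , Q , PathCovering-↭ σ cv , ↭-length σ , sym v≡last
  ... | p , Q , inj₁ v≡head , σ =
    N.reverse p , Q , PathCovering-reverse (PathCovering-↭ σ cv) , ↭-length σ ,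
    trans (last-reverse⁺ p) (sym v≡head)

  terminal-as-head : ∀ {P : Paths K} {v} → PathCovering K P → Any (Terminal v) P →
    Σ (List⁺ (Fin (n K))) λ p → Σ (Paths K) λ Q →
      PathCovering K (p ∷ Q) × L.length P ≡ suc (L.length Q) × N.head p ≡ v
  terminal-as-head cv t with bringToFront t
  ... | p , Q , inj₁ v≡head , σ = p , Q , PathCovering-↭ σ cv , ↭-length σ , sym v≡head
  ... | p , Q , inj₂ v≡last , σ =
    N.reverse p , Q , PathCovering-reverse (PathCovering-↭ σ cv) , ↭-length σ ,
    trans (head-reverse⁺ p) (sym v≡last)

module DisjointUnion (G H : Graph) where

  private
    m k : ℕ
    m = n G
    k = n H
    U : Graph
    U = G ⊔ H

  eL : Fin m → Fin (m + k)
  eL i = i ↑ˡ k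

  eR : Fin k → Fin (m + k)
  eR j = m ↑ʳ j

  eL-injective : ∀ {i j} → eL i ≡ eL j → i ≡ j
  eL-injective = ↑ˡ-injective k _ _

  eR-injective : ∀ {i j} → eR i ≡ eR j → i ≡ j
  eR-injective = ↑ʳ-injective m _ _

  eL≢eR : ∀ {i j} → eL i ≢ eR j
  eL≢eR {i} {j} e
    with () ← trans (sym (splitAt-↑ˡ m i k)) (trans (cong (splitAt m) e) (splitAt-↑ʳ m k j))

  eL∉map-eR : ∀ {i js} → eL i ∈ L.map eR js → ⊥
  eL∉map-eR i∈ = eL≢eR (proj₂ (proj₂ (∈-map⁻ eR i∈)))

  eR∉map-eL : ∀ {j is} → eR j ∈ L.map eL is → ⊥
  eR∉map-eL j∈ = eL≢eR (sym (proj₂ (proj₂ (∈-map⁻ eL j∈))))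

  data Side : Fin (m + k) → Set where
    left  : ∀ i → Side (eL i)
    right : ∀ j → Side (eR j)

  side : ∀ x → Side x
  side x with splitAt m x in e
  ... | inj₁ i = subst Side (splitAt⁻¹-↑ˡ e) (left i)
  ... | inj₂ j = subst Side (splitAt⁻¹-↑ʳ e) (right j)

  adj-eL-eL : ∀ i j → adj U (eL i) (eL j) ≡ adj G i j
  adj-eL-eL i j rewrite splitAt-↑ˡ m i k | splitAt-↑ˡ m j k = refl

  adj-eR-eR : ∀ i j → adj U (eR i) (eR j) ≡ adj H i j
  adj-eR-eR i j rewrite splitAt-↑ʳ m k i | splitAt-↑ʳ m k j = refl

  adj-eL-eR : ∀ i j → adj U (eL i) (eR j) ≡ false
  adj-eL-eR i j rewrite splitAt-↑ˡ m i k | splitAt-↑ʳ m k j = refl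

  adj-eR-eL : ∀ i j → adj U (eR i) (eL j) ≡ false
  adj-eR-eL i j rewrite splitAt-↑ʳ m k i | splitAt-↑ˡ m j k = refl

  data PathSide : List⁺ (Fin (m + k)) → Set where
    inG : ∀ q → PathSide (N.map eL q)
    inH : ∀ q → PathSide (N.map eR q)

  pathSide : ∀ p → IsPath U p → PathSide p
  pathSide (x ∷ []) _ with side x
  ... | left i  = inG (i ∷ [])
  ... | right j = inH (j ∷ [])
  pathSide (x ∷ y ∷ ys) (e ∷ lp) with pathSide (y ∷ ys) lp | side x
  ... | inG (j ∷ js) | left i  = inG (i ∷ j ∷ js)
  ... | inH (j ∷ js) | right i = inH (i ∷ j ∷ js)
  ... | inG (j ∷ js) | right i with () ← trans (sym (adj-eR-eL i j)) e
  ... | inH (j ∷ js) | left i  with () ← trans (sym (adj-eL-eR i j)) e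

  combine : Paths G → Paths H → Paths U
  combine P Q = L.map (N.map eL) P ++ L.map (N.map eR) Q

  length-combine : ∀ P Q → L.length (combine P Q) ≡ L.length P + L.length Q
  length-combine P Q =
    trans (length-++ (L.map (N.map eL) P))
          (cong₂ _+_ (length-map (N.map eL) P) (length-map (N.map eR) Q))

  vertices-combine : ∀ P Q →
                     vertices (combine P Q) ≡ L.map eL (vertices P) ++ L.map eR (vertices Q)
  vertices-combine P Q =
    trans (vertices-++ (L.map (N.map eL) P) _) (cong₂ _++_ (vertices-map eL P) (vertices-map eR Q))

  IsPath-eL⁺ : ∀ {q} → IsPath G q → IsPath U (N.map eL q)
  IsPath-eL⁺ {_ ∷ _} lq = Lk.map⁺ (Lk.map (λ {i} {j} e → trans (adj-eL-eL i j) e) lq)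

  IsPath-eL⁻ : ∀ {q} → IsPath U (N.map eL q) → IsPath G q
  IsPath-eL⁻ {_ ∷ _} lq = Lk.map (λ {i} {j} e → trans (sym (adj-eL-eL i j)) e) (Lk.map⁻ lq)

  IsPath-eR⁺ : ∀ {q} → IsPath H q → IsPath U (N.map eR q)
  IsPath-eR⁺ {_ ∷ _} lq = Lk.map⁺ (Lk.map (λ {i} {j} e → trans (adj-eR-eR i j) e) lq)

  IsPath-eR⁻ : ∀ {q} → IsPath U (N.map eR q) → IsPath H q
  IsPath-eR⁻ {_ ∷ _} lq = Lk.map (λ {i} {j} e → trans (sym (adj-eR-eR i j)) e) (Lk.map⁻ lq)

  PathCovering-combine⁺ : ∀ {P Q} → PathCovering G P → PathCovering H Q →
                          PathCovering U (combine P Q)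
  PathCovering-combine⁺ {P} {Q} cP cQ = record
    { paths    = All.++⁺ (All.map⁺ (All.map IsPath-eL⁺ (paths cP)))
                         (All.map⁺ (All.map IsPath-eR⁺ (paths cQ)))
    ; disjoint = subst Unique (sym (vertices-combine P Q))
                   (Unique.++⁺ (Unique.map⁺ eL-injective (disjoint cP))
                               (Unique.map⁺ eR-injective (disjoint cQ)) separated)
    ; covers   = λ x → subst (x ∈_) (sym (vertices-combine P Q)) (covered x (side x))
    }
    where
    separated : Disjoint (L.map eL (vertices P)) (L.map eR (vertices Q))
    separated (x∈P , x∈Q) with ∈-map⁻ eL x∈P
    ... | _ , _ , refl = eL∉map-eR x∈Q
    covered : ∀ x → Side x → x ∈ L.map eL (vertices P) ++ L.map eR (vertices Q)
    covered _ (left i)  = ∈-++⁺ˡ (∈-map⁺ eL (covers cP i))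
    covered _ (right j) = ∈-++⁺ʳ _ (∈-map⁺ eR (covers cQ j))

  PathCovering-combine⁻ : ∀ {P Q} → PathCovering U (combine P Q) →
                          PathCovering G P × PathCovering H Q
  PathCovering-combine⁻ {P} {Q} c with All.++⁻ (L.map (N.map eL) P) (paths c)
                                     | Unique-++⁻ (L.map eL (vertices P))
                                                  (subst Unique (vertices-combine P Q) (disjoint c))
  ... | paths-P , paths-Q | unique-P , unique-Q , _ =
    record { paths    = All.map IsPath-eL⁻ (All.map⁻ paths-P)
           ; disjoint = Unique.map⁻ unique-P
           ; covers   = covers-P
           } ,
    record { paths    = All.map IsPath-eR⁻ (All.map⁻ paths-Q)
           ; disjoint = Unique.map⁻ unique-Q
           ; covers   = covers-Q
           }
    where
    covered : ∀ x → x ∈ L.map eL (vertices P) ⊎ x ∈ L.map eR (vertices Q)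
    covered x = ∈-++⁻ (L.map eL (vertices P)) (subst (x ∈_) (vertices-combine P Q) (covers c x))
    covers-P : ∀ i → i ∈ vertices P
    covers-P i = [ ∈-map-injective⁻ eL-injective , ⊥-elim ∘ eL∉map-eR ]′ (covered (eL i))
    covers-Q : ∀ j → j ∈ vertices Q
    covers-Q j = [ ⊥-elim ∘ eR∉map-eL , ∈-map-injective⁻ eR-injective ]′ (covered (eR j))

  sortBySide : ∀ D → All (IsPath U) D →
               Σ (Paths G) λ P → Σ (Paths H) λ Q → D ↭ combine P Q
  sortBySide []      []         = [] , [] , ↭-refl
  sortBySide (p ∷ D) (lp ∷ lD) with sortBySide D lD | pathSide p lp
  ... | P , Q , σ | inG q = q ∷ P , Q , prep _ σ
  ... | P , Q , σ | inH q =
    P , q ∷ Q , ↭-trans (prep _ σ) (↭-sym (shift _ (L.map (N.map eL) P) _))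

  PathCovering-⊔⁻ : ∀ {D} → PathCovering U D →
    Σ (Paths G) λ P → Σ (Paths H) λ Q → PathCovering G P × PathCovering H Q × D ↭ combine P Q
  PathCovering-⊔⁻ {D} c with sortBySide D (paths c)
  ... | P , Q , σ = P , Q , proj₁ cPQ , proj₂ cPQ , σ
    where
    cPQ : PathCovering G P × PathCovering H Q
    cPQ = PathCovering-combine⁻ (PathCovering-↭ σ c)

  -- A shorter covering of one side, combined with the other side,
  -- would be a shorter covering of G ⊔ H.
  MinimalCovering-⊔⁻ : ∀ {D} → MinimalCovering U D →
    Σ (Paths G) λ P → Σ (Paths H) λ Q →
      MinimalCovering G P × MinimalCovering H Q × D ↭ combine P Q
  MinimalCovering-⊔⁻ {D} (c , minimal) with PathCovering-⊔⁻ c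
  ... | P , Q , cP , cQ , σ = P , Q , (cP , minimalP) , (cQ , minimalQ) , σ
    where
    |D| : L.length D ≡ L.length P + L.length Q
    |D| = trans (↭-length σ) (length-combine P Q)
    minimalP : ∀ t → HasCovering G t → L.length P ≤ t
    minimalP _ (E , cE , refl) = +-cancelʳ-≤ (L.length Q) _ _
      (subst (_≤ _) |D| (minimal _ (combine E Q , PathCovering-combine⁺ cE cQ , length-combine E Q)))
    minimalQ : ∀ t → HasCovering H t → L.length Q ≤ t
    minimalQ _ (E , cE , refl) = +-cancelˡ-≤ (L.length P) _ _
      (subst (_≤ _) |D| (minimal _ (combine P E , PathCovering-combine⁺ cP cE , length-combine P E)))

  μ-⊔-lowerBound : ∀ {P Q b} → MinimalCovering G P → MinimalCovering H Q → HasCovering U b →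
                   L.length P + L.length Q ≤ b
  μ-⊔-lowerBound (_ , minimalP) (_ , minimalQ) (D , c , refl) with PathCovering-⊔⁻ c
  ... | P , Q , cP , cQ , σ =
    subst (_ ≤_) (sym (trans (↭-length σ) (length-combine P Q)))
          (+-mono-≤ (minimalP _ (P , cP , refl)) (minimalQ _ (Q , cQ , refl)))

  Terminal-combineˡ : ∀ {v P Q} → Any (Terminal (eL v)) (combine P Q) → Any (Terminal v) P
  Terminal-combineˡ {P = P} t with Any.++⁻ (L.map (N.map eL) P) t
  ... | inj₁ tP = Any.map (λ {q} → Terminal-map-injective⁻ eL-injective {q = q}) (Any.map⁻ tP)
  ... | inj₂ tQ with Any.satisfied (Any.map⁻ tQ)
  ...   | q , t′ = ⊥-elim (eL≢eR (proj₁ (proj₂ (Terminal-map⁻ q t′))))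

  Terminal-combineʳ : ∀ {w P Q} → Any (Terminal (eR w)) (combine P Q) → Any (Terminal w) Q
  Terminal-combineʳ {P = P} t with Any.++⁻ (L.map (N.map eL) P) t
  ... | inj₂ tQ = Any.map (λ {q} → Terminal-map-injective⁻ eR-injective {q = q}) (Any.map⁻ tQ)
  ... | inj₁ tP with Any.satisfied (Any.map⁻ tP)
  ...   | q , t′ = ⊥-elim (eL≢eR (sym (proj₁ (proj₂ (Terminal-map⁻ q t′)))))

  T-⊔ˡ : ∀ {D v} → MinimalCovering U D → Any (Terminal (eL v)) D → T G v
  T-⊔ˡ mc t with MinimalCovering-⊔⁻ mc
  ... | _ , _ , mP , _ , σ = T-intro mP (Terminal-combineˡ (Any-resp-↭ σ t))

  T-⊔ʳ : ∀ {D w} → MinimalCovering U D → Any (Terminal (eR w)) D → T H w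
  T-⊔ʳ mc t with MinimalCovering-⊔⁻ mc
  ... | _ , _ , _ , mQ , σ = T-intro mQ (Terminal-combineʳ (Any-resp-↭ σ t))

module AddEdge (K : Graph) (a b : Fin (n K)) where
  open Equivalence

  private
    V : Set
    V = Fin (n K)
    K⁺ : Graph
    K⁺ = addEdge K a b

  NewEdge : V → V → Set
  NewEdge x y = (x ≡ a × y ≡ b) ⊎ (x ≡ b × y ≡ a)

  Adjacent-addEdge⁺ : ∀ {x y} → Adjacent K x y → Adjacent K⁺ x y
  Adjacent-addEdge⁺ e = cong (_∨ _) e

  Adjacent-addEdge-new : Adjacent K⁺ a b
  Adjacent-addEdge-new =
    T-≡ .to (T-∨ {adj K a b} .from (inj₂ (T-∨ {⌊ a ≟ a ⌋ ∧ ⌊ b ≟ b ⌋} .from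
      (inj₁ (T-∧ {⌊ a ≟ a ⌋} .from (fromWitness refl , fromWitness refl))))))

  Adjacent-addEdge⁻ : ∀ {x y} → Adjacent K⁺ x y → Adjacent K x y ⊎ NewEdge x y
  Adjacent-addEdge⁻ {x} {y} e with T-∨ {adj K x y} .to (T-≡ .from e)
  ... | inj₁ old = inj₁ (T-≡ .to old)
  ... | inj₂ new with T-∨ {⌊ x ≟ a ⌋ ∧ ⌊ y ≟ b ⌋} .to new
  ...   | inj₁ ab = let (x≡a , y≡b) = T-∧ {⌊ x ≟ a ⌋} .to ab in
                    inj₂ (inj₁ (toWitness x≡a , toWitness y≡b))
  ...   | inj₂ ba = let (x≡b , y≡a) = T-∧ {⌊ x ≟ b ⌋} .to ba in
                    inj₂ (inj₂ (toWitness x≡b , toWitness y≡a))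

  PathCovering-addEdge⁺ : ∀ {P} → PathCovering K P → PathCovering K⁺ P
  PathCovering-addEdge⁺ c = record
    { paths    = All.map (Lk.map Adjacent-addEdge⁺) (paths c)
    ; disjoint = disjoint c
    ; covers   = covers c
    }

  Linked-addEdge⁻ : ∀ {xs} → ¬ (a ∈ xs × b ∈ xs) →
                    Linked (Adjacent K⁺) xs → Linked (Adjacent K) xs
  Linked-addEdge⁻ _ []  = []
  Linked-addEdge⁻ _ [-] = [-]
  Linked-addEdge⁻ ¬ab (e ∷ l) with Adjacent-addEdge⁻ e
  ... | inj₁ old = old ∷ Linked-addEdge⁻ (λ (a∈ , b∈) → ¬ab (there a∈ , there b∈)) l
  ... | inj₂ (inj₁ (refl , refl)) = ⊥-elim (¬ab (here refl , there (here refl)))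
  ... | inj₂ (inj₂ (refl , refl)) = ⊥-elim (¬ab (there (here refl) , here refl))

  record Cut (p : List⁺ V) : Set where
    constructor cut
    field
      front back : List⁺ V
      front-path : IsPath K front
      back-path  : IsPath K back
      splits     : toList front ++ toList back ≡ toList p
      junction   : NewEdge (N.last front) (N.head back)

  Cut-∷ : ∀ {x p} → Adjacent K x (N.head p) → Cut p → Cut (x N.∷⁺ p)
  Cut-∷ {x} e (cut (f ∷ fs) back lf lb refl j) =
    cut (x ∷ f ∷ fs) back (e ∷ lf) lb refl
        (subst (λ z → NewEdge z (N.head back)) (sym (last-∷⁺ x (f ∷ fs))) j)

  -- Beyond the first new edge xy the path avoids x ∈ {a, b}, so what remains is a path of K:
  -- one cut suffices.
  cutAtNewEdge : ∀ p → IsPath K⁺ p → Unique (toList p) → IsPath K p ⊎ Cut p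
  cutAtNewEdge (x ∷ [])     _       _          = inj₁ [-]
  cutAtNewEdge (x ∷ y ∷ ys) (e ∷ l) (x∉ ∷ u) with Adjacent-addEdge⁻ e
  ... | inj₂ new = inj₂ (cut (x ∷ []) (y ∷ ys) [-] (Linked-addEdge⁻ (avoids new) l) refl new)
    where
    avoids : NewEdge x y → ¬ (a ∈ y ∷ ys × b ∈ y ∷ ys)
    avoids (inj₁ (refl , _)) (a∈ , _) = All¬⇒¬Any x∉ a∈
    avoids (inj₂ (refl , _)) (_ , b∈) = All¬⇒¬Any x∉ b∈
  ... | inj₁ old with cutAtNewEdge (y ∷ ys) l u
  ...   | inj₁ l′ = inj₁ (old ∷ l′)
  ...   | inj₂ c  = inj₂ (Cut-∷ old c)

  Cut-terminals : ∀ {f bk} {P : Paths K} → NewEdge (N.last f) (N.head bk) →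
                  Any (Terminal a) (f ∷ bk ∷ P) × Any (Terminal b) (f ∷ bk ∷ P)
  Cut-terminals (inj₁ (l≡a , h≡b)) = here (inj₂ (sym l≡a)) , there (here (inj₁ (sym h≡b)))
  Cut-terminals (inj₂ (l≡b , h≡a)) = there (here (inj₁ (sym h≡a))) , here (inj₂ (sym l≡b))

  PathCovering-addEdge⁻ : ∀ {P} → All (IsPath K) P → PathCovering K⁺ P → PathCovering K P
  PathCovering-addEdge⁻ ps c = record { paths = ps ; disjoint = disjoint c ; covers = covers c }

  data CoveringWithoutEdge (ℓ : ℕ) : Set where
    unchanged   : ∀ {Q} → PathCovering K Q → L.length Q ≡ ℓ → CoveringWithoutEdge ℓ
    splitAtEdge : ∀ {Q} → PathCovering K Q → L.length Q ≡ suc ℓ →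
                  Any (Terminal a) Q → Any (Terminal b) Q → CoveringWithoutEdge ℓ

  PathCovering-deleteEdge-at : ∀ {p P} → PathCovering K⁺ (p ∷ P) → a ∈ toList p →
                               CoveringWithoutEdge (L.length (p ∷ P))
  PathCovering-deleteEdge-at {p} {P} c a∈p with paths c | Unique-++⁻ (toList p) (disjoint c)
  ... | lp ∷ lP | u-p , _ , p#P = cutOrKeep (cutAtNewEdge p lp u-p)
    where
    P-paths : All (IsPath K) P
    P-paths = All.zipWith (λ (l , a∉q) → Linked-addEdge⁻ (λ (a∈ , _) → a∉q a∈) l)
                 (lP , ¬Any⇒All¬ P (λ a∈P → p#P (a∈p , ∈-concatMap⁺ toList a∈P)))

    cutOrKeep : IsPath K p ⊎ Cut p → CoveringWithoutEdge (L.length (p ∷ P))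
    cutOrKeep (inj₁ lK) = unchanged (PathCovering-addEdge⁻ (lK ∷ P-paths) c) refl
    cutOrKeep (inj₂ (cut f bk lf lb splits j)) =
      splitAtEdge (PathCovering-addEdge⁻ Q-paths c′) refl
                  (proj₁ (Cut-terminals j)) (proj₂ (Cut-terminals j))
      where
      Q-paths : All (IsPath K) (f ∷ bk ∷ P)
      Q-paths = lf ∷ lb ∷ P-paths
      resplit : toList p ++ vertices P ≡ toList f ++ toList bk ++ vertices P
      resplit = trans (cong (_++ vertices P) (sym splits)) (++-assoc (toList f) (toList bk) (vertices P))
      c′ : PathCovering K⁺ (f ∷ bk ∷ P)
      c′ = PathCovering-resp (All.map (Lk.map Adjacent-addEdge⁺) Q-paths) (↭-reflexive resplit) c

  PathCovering-deleteEdge : ∀ {P} → PathCovering K⁺ P → CoveringWithoutEdge (L.length P)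
  PathCovering-deleteEdge c with bringToFront (∈-concatMap⁻ toList (covers c a))
  ... | p , P′ , a∈p , σ =
    subst CoveringWithoutEdge (sym (↭-length σ)) (PathCovering-deleteEdge-at (PathCovering-↭ σ c) a∈p)

module JoinAt (G H : Graph) (v : Fin (n G)) (w : Fin (n H)) where
  open DisjointUnion G H
  open AddEdge (G ⊔ H) (eL v) (eR w)

  μ-joinAt≤μ-⊔ : ∀ {a b} → IsMu (joinAt G H v w) a → IsMu (G ⊔ H) b → a ≤ b
  μ-joinAt≤μ-⊔ (_ , minimal) ((B , c , |B|) , _) = minimal _ (B , PathCovering-addEdge⁺ c , |B|)

  μ-⊔≤μ-joinAt-or-both-terminal : ∀ {a b} → IsMu (joinAt G H v w) a → IsMu (G ⊔ H) b →
                                  b ≤ a ⊎ (b ≡ suc a × T G v × T H w)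
  μ-⊔≤μ-joinAt-or-both-terminal {b = b} ((A , c , refl) , _) (_ , minimal)
    with PathCovering-deleteEdge c
  ... | unchanged cQ |Q| = inj₁ (subst (b ≤_) |Q| (minimal _ (_ , cQ , refl)))
  ... | splitAtEdge {Q} cQ |Q| tv tw with b ≤? L.length A
  ...   | yes b≤a = inj₁ b≤a
  ...   | no  b≰a = inj₂ (b≡1+a , T-⊔ˡ mQ tv , T-⊔ʳ mQ tw)
    where
    a<b : suc (L.length A) ≤ b
    a<b = ≰⇒> b≰a
    b≡1+a : b ≡ suc (L.length A)
    b≡1+a = ≤-antisym (subst (b ≤_) |Q| (minimal _ (Q , cQ , refl))) a<b
    mQ : MinimalCovering (G ⊔ H) Q
    mQ = cQ , λ t hc → subst (_≤ t) (sym |Q|) (≤-trans a<b (minimal t hc))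

  μ-joinAt<μ-⊔ : ∀ {a b} → IsSimpleGraph G → IsSimpleGraph H → T G v → T H w →
                 IsMu (joinAt G H v w) a → IsMu (G ⊔ H) b → suc a ≤ b
  μ-joinAt<μ-⊔ {a} {b} sG sH (P , cP , (_ , minP) , tv) (Q , cQ , (_ , minQ) , tw) (_ , minimal) (hB , _)
    with terminal-as-last (IsSimpleGraph.symmetric sG) cP tv
       | terminal-as-head (IsSimpleGraph.symmetric sH) cQ tw
  ... | p , P′ , cP′ , |P| , last≡v | q , Q′ , cQ′ , |Q| , head≡w = begin
    suc a                                  ≤⟨ s≤s (minimal _ (_ , joined , refl)) ⟩
    suc (suc (L.length (combine P′ Q′)))   ≡⟨ cong (λ l → suc (suc l)) (length-combine P′ Q′) ⟩
    suc (suc (L.length P′ + L.length Q′))  ≡⟨ cong suc (+-suc (L.length P′) (L.length Q′)) ⟨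
    suc (L.length P′) + suc (L.length Q′)  ≡⟨ cong₂ _+_ |P| |Q| ⟨
    L.length P + L.length Q                ≤⟨ μ-⊔-lowerBound (cP , minP) (cQ , minQ) hB ⟩
    b                                      ∎
    where
    open ≤-Reasoning
    adjacent : Adjacent (joinAt G H v w) (N.last (N.map eL p)) (N.head (N.map eR q))
    adjacent = subst₂ (Adjacent (joinAt G H v w)) (sym (trans (last-map⁺ eL p) (cong eL last≡v)))
                      (sym (cong eR head≡w)) Adjacent-addEdge-new
    joined : PathCovering (joinAt G H v w) ((N.map eL p N.⁺++⁺ N.map eR q) ∷ combine P′ Q′)
    joined = PathCovering-join adjacent
               (PathCovering-↭ (prep _ (shift _ (L.map (N.map eL) P′) _))
                 (PathCovering-addEdge⁺ (PathCovering-combine⁺ cP′ cQ′)))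

lemma2p7 : (G H : Graph) → IsSimpleGraph G → IsSimpleGraph H →
    (v : Fin (n G)) (w : Fin (n H)) →
    (a b : ℕ) → IsMu (joinAt G H v w) a → IsMu (G ⊔ H) b →
    ((T G v × T H w) → a ≡ b ∸ 1) × (¬ (T G v × T H w) → a ≡ b)
lemma2p7 G H sG sH v w a b μa μb = both , notBoth
  where
  open JoinAt G H v w
  both : T G v × T H w → a ≡ b ∸ 1
  both (tv , tw) with μ-⊔≤μ-joinAt-or-both-terminal μa μb
  ... | inj₁ b≤a             = ⊥-elim (<⇒≱ (μ-joinAt<μ-⊔ sG sH tv tw μa μb) b≤a)
  ... | inj₂ (b≡1+a , _ , _) = sym (cong (_∸ 1) b≡1+a)
  notBoth : ¬ (T G v × T H w) → a ≡ b
  notBoth ¬both with μ-⊔≤μ-joinAt-or-both-terminal μa μb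
  ... | inj₁ b≤a           = ≤-antisym (μ-joinAt≤μ-⊔ μa μb) b≤a
  ... | inj₂ (_ , tv , tw) = ⊥-elim (¬both (tv , tw))
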